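{- There exist a unital Specker $\ell$-group $(G,u)$ and an $\ell$-subgroup $H$ of $G$ containing $u$ (so that $(H,u)$ is a unital $\ell$-subgroup of $(G,u)$) such that $(H,u)$ is not a unital Specker $\ell$-group.
   Context: An $\ell$-group is a lattice-ordered abelian group. A unit of $G$ is $u\ge0$ such that each $g\in G$ satisfies $|g|\le nu$ for some $n\in\mathbb Z_{>0}$; $(G,u)$ is then a unital $\ell$-group. A singular element of $G$ is $s\ge0$ with $a\wedge(s-a)=0$ for all $0\le a\le s$. A Specker $\ell$-group is an $\ell$-group generated as a group by its singular elements; a unital Specker $\ell$-group is $(S,u)$ with $S$ Specker and $u$ a unit. -}

module Defs where

open import Level using (Level; _⊔_; suc)
open import Data.Nat using (ℕ; zero) renaming (suc to 1+; _>_ to _>ℕ_)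
open import Data.Product using (Σ; _,_; proj₁; proj₂; _×_)
open import Relation.Binary.Structures using (IsEquivalence)
open import Algebra.Structures using (IsAbelianGroup; IsGroup; IsMonoid; IsSemigroup; IsMagma)
open import Algebra.Lattice.Structures using (IsLattice)

record LGroup (c ℓ : Level) : Set (suc (c ⊔ ℓ)) where
  infixl 6 _+_ _-_
  infixr 7 _∧_ _∨_
  infix 4 _≈_ _≤_
  field
    Carrier : Set c
    _≈_ : Carrier → Carrier → Set ℓ
    _+_ : Carrier → Carrier → Carrier
    0# : Carrier
    -_ : Carrier → Carrier
    _∧_ : Carrier → Carrier → Carrier
    _∨_ : Carrier → Carrier → Carrier
    isAbelianGroup : IsAbelianGroup _≈_ _+_ 0# -_
    isLattice : IsLattice _≈_ _∨_ _∧_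

  _≤_ : Carrier → Carrier → Set ℓ
  x ≤ y = (x ∧ y) ≈ x

  field
    +-mono-≤ : ∀ x y z → x ≤ y → (x + z) ≤ (y + z)

  _-_ : Carrier → Carrier → Carrier
  x - y = x + (- y)

  ∣_∣ : Carrier → Carrier
  ∣ x ∣ = x ∨ (- x)

  _·_ : ℕ → Carrier → Carrier
  zero · x = 0#
  1+ n · x = x + (n · x)

  IsUnit : Carrier → Set (c ⊔ ℓ)
  IsUnit u = (0# ≤ u) × (∀ g → Σ ℕ λ n → (n >ℕ 0) × (∣ g ∣ ≤ (n · u)))

  IsSingular : Carrier → Set (c ⊔ ℓ)
  IsSingular s = (0# ≤ s) × (∀ a → 0# ≤ a → a ≤ s → (a ∧ (s - a)) ≈ 0#)

  data InSubgroupGeneratedBy {p} (P : Carrier → Set p) : Carrier → Set (c ⊔ ℓ ⊔ p) where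
    gen-base : ∀ {x} → P x → InSubgroupGeneratedBy P x
    gen-zero : InSubgroupGeneratedBy P 0#
    gen-neg  : ∀ {x} → InSubgroupGeneratedBy P x → InSubgroupGeneratedBy P (- x)
    gen-add  : ∀ {x y} → InSubgroupGeneratedBy P x → InSubgroupGeneratedBy P y
             → InSubgroupGeneratedBy P (x + y)
    gen-resp : ∀ {x y} → x ≈ y → InSubgroupGeneratedBy P x → InSubgroupGeneratedBy P y

  IsSpecker : Set (c ⊔ ℓ)
  IsSpecker = ∀ g → InSubgroupGeneratedBy IsSingular g

  IsUnitalSpecker : Carrier → Set (c ⊔ ℓ)
  IsUnitalSpecker u = IsSpecker × IsUnit u

record LSubgroup {c ℓ} (G : LGroup c ℓ) (p : Level) : Set (c ⊔ ℓ ⊔ suc p) where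
  open LGroup G
  field
    Member : Carrier → Set p
    resp : ∀ {x y} → x ≈ y → Member x → Member y
    0∈ : Member 0#
    +∈ : ∀ {x y} → Member x → Member y → Member (x + y)
    -∈ : ∀ {x} → Member x → Member (- x)
    ∧∈ : ∀ {x y} → Member x → Member y → Member (x ∧ y)
    ∨∈ : ∀ {x y} → Member x → Member y → Member (x ∨ y)

subLGroup : ∀ {c ℓ p} (G : LGroup c ℓ) → LSubgroup G p → LGroup (c ⊔ p) ℓ
subLGroup G H = record
  { Carrier = C
  ; _≈_ = _≈'_
  ; _+_ = λ x y → (proj₁ x + proj₁ y) , +∈ (proj₂ x) (proj₂ y)
  ; 0# = 0# , 0∈
  ; -_ = λ x → (- proj₁ x) , -∈ (proj₂ x)
  ; _∧_ = λ x y → (proj₁ x ∧ proj₁ y) , ∧∈ (proj₂ x) (proj₂ y)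
  ; _∨_ = λ x y → (proj₁ x ∨ proj₁ y) , ∨∈ (proj₂ x) (proj₂ y)
  ; isAbelianGroup = record
    { isGroup = record
      { isMonoid = record
        { isSemigroup = record
          { isMagma = record
            { isEquivalence = eq
            ; ∙-cong = AG.∙-cong }
          ; assoc = λ x y z → AG.assoc (proj₁ x) (proj₁ y) (proj₁ z) }
        ; identity = (λ x → proj₁ AG.identity (proj₁ x)) , (λ x → proj₂ AG.identity (proj₁ x)) }
      ; inverse = (λ x → proj₁ AG.inverse (proj₁ x)) , (λ x → proj₂ AG.inverse (proj₁ x))
      ; ⁻¹-cong = AG.⁻¹-cong }
    ; comm = λ x y → AG.comm (proj₁ x) (proj₁ y) }
  ; isLattice = record
    { isEquivalence = eq
    ; ∨-comm = λ x y → L.∨-comm (proj₁ x) (proj₁ y)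
    ; ∨-assoc = λ x y z → L.∨-assoc (proj₁ x) (proj₁ y) (proj₁ z)
    ; ∨-cong = L.∨-cong
    ; ∧-comm = λ x y → L.∧-comm (proj₁ x) (proj₁ y)
    ; ∧-assoc = λ x y z → L.∧-assoc (proj₁ x) (proj₁ y) (proj₁ z)
    ; ∧-cong = L.∧-cong
    ; absorptive = (λ x y → proj₁ L.absorptive (proj₁ x) (proj₁ y))
                 , (λ x y → proj₂ L.absorptive (proj₁ x) (proj₁ y)) }
  ; +-mono-≤ = λ x y z → +-mono-≤ (proj₁ x) (proj₁ y) (proj₁ z)
  }
  where
  open LGroup G
  open LSubgroup H
  module AG = IsAbelianGroup isAbelianGroup
  module L = IsLattice isLattice
  C = Σ Carrier Member
  _≈'_ : C → C → Set _
  x ≈' y = proj₁ x ≈ proj₁ y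
  eq : IsEquivalence _≈'_
  eq = record { refl = AG.refl ; sym = AG.sym ; trans = AG.trans }

-- Take G to be the eventually constant integer sequences with the pointwise order and unit the
-- constant 2, and H the ℓ-subgroup of sequences whose eventual value is even. G is Specker:
-- a sequence that is constant c from N on is c·𝟙 plus integer multiples of the indicators of
-- the points below N, and those are all singular. In H, however, a singular s with eventual
-- value 2k dominates k times the indicator of a point in its constant tail; singularity then
-- forces k ⊓ (2k − k) = 0, so k = 0. Hence every group combination of singular elements of H
-- is eventually zero, and the unit 2 is not.
module Submission where

open import Defs
open import Level using (0ℓ) renaming (_⊔_ to _⊔ˡ_)
open import Function using (_∘_)
open import Data.Empty using (⊥-elim)
open import Data.Product using (Σ; ∃; _,_; _×_; proj₁; proj₂)
open import Data.Sum using (_⊎_; inj₁; inj₂)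
open import Data.Nat as ℕ using (ℕ; zero; suc; z≤n; s≤s) renaming (_≤_ to _≤ℕ_)
import Data.Nat.Properties as ℕ
open import Relation.Binary.PropositionalEquality
  using (_≡_; _≢_; refl; sym; trans; cong; cong₂; subst; subst₂; module ≡-Reasoning)
open import Relation.Binary.Structures using (IsEquivalence)
open import Relation.Nullary using (¬_; yes; no)

module _ {c ℓ} (G : LGroup c ℓ) where
  open LGroup G

  record IsSubgroup {q} (Q : Carrier → Set q) : Set (c ⊔ˡ ℓ ⊔ˡ q) where
    field
      resp : ∀ {x y} → x ≈ y → Q x → Q y
      0∈ : Q 0#
      -∈ : ∀ {x} → Q x → Q (- x)
      +∈ : ∀ {x y} → Q x → Q y → Q (x + y)

  generated⊆subgroup : ∀ {p q} {P : Carrier → Set p} {Q : Carrier → Set q} →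
    IsSubgroup Q → (∀ {x} → P x → Q x) → ∀ {x} → InSubgroupGeneratedBy P x → Q x
  generated⊆subgroup {P = P} {Q} Q-sub P⊆Q = go
    where
    open IsSubgroup Q-sub
    go : ∀ {x} → InSubgroupGeneratedBy P x → Q x
    go (gen-base Px) = P⊆Q Px
    go gen-zero = 0∈
    go (gen-neg x∈) = -∈ (go x∈)
    go (gen-add x∈ y∈) = +∈ (go x∈) (go y∈)
    go (gen-resp x≈y x∈) = resp x≈y (go x∈)

  ·-generated : ∀ {p} {P : Carrier → Set p} n {x} →
    InSubgroupGeneratedBy P x → InSubgroupGeneratedBy P (n · x)
  ·-generated zero x∈ = gen-zero
  ·-generated (suc n) x∈ = gen-add x∈ (·-generated n x∈)

-- Opened only here: ℤ's operators would clash with the LGroup fields opened above.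
open import Data.Integer
  using (ℤ; +_; -[1+_]; _+_; _-_; _*_; -_; _⊓_; _⊔_; 0ℤ; 1ℤ; _≤_; +≤+; ∣_∣; nonNegative)
open import Data.Integer.Properties
open import Data.Integer.Tactic.RingSolver using (solve-∀)

Eventually : ∀ {p} → (ℕ → Set p) → Set p
Eventually P = ∃ λ N → ∀ n → N ≤ℕ n → P n

eventually-map : ∀ {p q} {P : ℕ → Set p} {Q : ℕ → Set q} →
  (∀ {n} → P n → Q n) → Eventually P → Eventually Q
eventually-map f (N , p) = N , λ n N≤n → f (p n N≤n)

eventually-map₂ : ∀ {p q r} {P : ℕ → Set p} {Q : ℕ → Set q} {R : ℕ → Set r} →
  (∀ {n} → P n → Q n → R n) → Eventually P → Eventually Q → Eventually R
eventually-map₂ f (N , p) (M , q) = N ℕ.⊔ M , λ n N⊔M≤n →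
  f (p n (ℕ.m⊔n≤o⇒m≤o N M N⊔M≤n)) (q n (ℕ.m⊔n≤o⇒n≤o N M N⊔M≤n))

EventuallyConstant : (ℕ → ℤ) → Set
EventuallyConstant f = ∃ λ c → Eventually (λ n → f n ≡ c)

Seq : Set
Seq = Σ (ℕ → ℤ) EventuallyConstant

infixl 9 _!_
_!_ : Seq → ℕ → ℤ
_!_ = proj₁

constant : ℤ → Seq
constant c = (λ _ → c) , c , 0 , λ _ _ → refl

pointwise₁ : (ℤ → ℤ) → Seq → Seq
pointwise₁ f x .proj₁ n = f (x ! n)
pointwise₁ f (_ , c , x→c) .proj₂ = f c , eventually-map (cong f) x→c

pointwise₂ : (ℤ → ℤ → ℤ) → Seq → Seq → Seq
pointwise₂ _∙_ x y .proj₁ n = (x ! n) ∙ (y ! n)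
pointwise₂ _∙_ (_ , c , x→c) (_ , d , y→d) .proj₂ = c ∙ d , eventually-map₂ (cong₂ _∙_) x→c y→d

scale : ℤ → Seq → Seq
scale k = pointwise₁ (k *_)

δ : ℕ → ℕ → ℤ
δ zero    zero    = 1ℤ
δ zero    (suc n) = 0ℤ
δ (suc m) zero    = 0ℤ
δ (suc m) (suc n) = δ m n

δ-diag : ∀ m → δ m m ≡ 1ℤ
δ-diag zero = refl
δ-diag (suc m) = δ-diag m

δ-off : ∀ {m n} → m ≢ n → δ m n ≡ 0ℤ
δ-off {zero}  {zero}  m≢n = ⊥-elim (m≢n refl)
δ-off {zero}  {suc n} _   = refl
δ-off {suc m} {zero}  _   = refl
δ-off {suc m} {suc n} m≢n = δ-off (m≢n ∘ cong suc)

δ-binary : ∀ m n → δ m n ≡ 0ℤ ⊎ δ m n ≡ 1ℤ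
δ-binary zero    zero    = inj₂ refl
δ-binary zero    (suc n) = inj₁ refl
δ-binary (suc m) zero    = inj₁ refl
δ-binary (suc m) (suc n) = δ-binary m n

indicator : ℕ → Seq
indicator m = δ m , 0ℤ , suc m , λ n m<n → δ-off (ℕ.<⇒≢ m<n)

_≋_ : Seq → Seq → Set
x ≋ y = ∀ n → x ! n ≡ y ! n

≋-isEquivalence : IsEquivalence _≋_
≋-isEquivalence = record
  { refl = λ n → refl ; sym = λ x≋y n → sym (x≋y n) ; trans = λ x≋y y≋z n → trans (x≋y n) (y≋z n) }

seqLGroup : LGroup 0ℓ 0ℓ
seqLGroup = record
  { Carrier = Seq ; _≈_ = _≋_ ; _+_ = pointwise₂ _+_ ; 0# = constant 0ℤ ; -_ = pointwise₁ (-_)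
  ; _∧_ = pointwise₂ _⊓_ ; _∨_ = pointwise₂ _⊔_
  ; isAbelianGroup = record
    { isGroup = record
      { isMonoid = record
        { isSemigroup = record
          { isMagma = record
            { isEquivalence = ≋-isEquivalence ; ∙-cong = λ x≋y u≋v n → cong₂ _+_ (x≋y n) (u≋v n) }
          ; assoc = λ x y z n → +-assoc (x ! n) (y ! n) (z ! n) }
        ; identity = (λ x n → +-identityˡ (x ! n)) , (λ x n → +-identityʳ (x ! n)) }
      ; inverse = (λ x n → +-inverseˡ (x ! n)) , (λ x n → +-inverseʳ (x ! n))
      ; ⁻¹-cong = λ x≋y n → cong (-_) (x≋y n) }
    ; comm = λ x y n → +-comm (x ! n) (y ! n) }
  ; isLattice = record
    { isEquivalence = ≋-isEquivalence
    ; ∨-comm = λ x y n → ⊔-comm (x ! n) (y ! n)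
    ; ∨-assoc = λ x y z n → ⊔-assoc (x ! n) (y ! n) (z ! n)
    ; ∨-cong = λ x≋y u≋v n → cong₂ _⊔_ (x≋y n) (u≋v n)
    ; ∧-comm = λ x y n → ⊓-comm (x ! n) (y ! n)
    ; ∧-assoc = λ x y z n → ⊓-assoc (x ! n) (y ! n) (z ! n)
    ; ∧-cong = λ x≋y u≋v n → cong₂ _⊓_ (x≋y n) (u≋v n)
    ; absorptive = (λ x y n → proj₁ ⊔-⊓-absorptive (x ! n) (y ! n))
                 , (λ x y n → proj₂ ⊔-⊓-absorptive (x ! n) (y ! n)) }
  ; +-mono-≤ = λ x y z x≤y n → i≤j⇒i⊓j≡i (+-monoˡ-≤ (z ! n) (i⊓j≡i⇒i≤j (x≤y n)))
  }

module 𝔾 = LGroup seqLGroup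

·-pointwise : ∀ n x m → (n 𝔾.· x) ! m ≡ + n * x ! m
·-pointwise zero    x m = sym (*-zeroˡ (x ! m))
·-pointwise (suc n) x m =
  trans (cong (λ t → x ! m + t) (·-pointwise n x m)) (sym (suc-* (+ n) (x ! m)))

scale-generated : ∀ {p} {P : Seq → Set p} k x →
  𝔾.InSubgroupGeneratedBy P x → 𝔾.InSubgroupGeneratedBy P (scale k x)
scale-generated (+ n) x x∈ = 𝔾.gen-resp (·-pointwise n x) (·-generated seqLGroup n x∈)
scale-generated -[1+ n ] x x∈ = 𝔾.gen-resp
  (λ m → trans (cong (-_) (·-pointwise (suc n) x m)) (neg-distribˡ-* (+ suc n) (x ! m)))
  (𝔾.gen-neg (·-generated seqLGroup (suc n) x∈))

binary-nonNeg : ∀ {s} → s ≡ 0ℤ ⊎ s ≡ 1ℤ → 0ℤ ≤ s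
binary-nonNeg (inj₁ refl) = ≤-refl
binary-nonNeg (inj₂ refl) = +≤+ z≤n

binary-⊓-complement : ∀ {s a} → s ≡ 0ℤ ⊎ s ≡ 1ℤ → 0ℤ ≤ a → a ≤ s → a ⊓ (s - a) ≡ 0ℤ
binary-⊓-complement {a = + zero}          (inj₁ refl) _ _ = refl
binary-⊓-complement {a = + zero}          (inj₂ refl) _ _ = refl
binary-⊓-complement {a = + suc zero}      (inj₂ refl) _ _ = refl
binary-⊓-complement {a = + suc _}         (inj₁ refl) _ (+≤+ ())
binary-⊓-complement {a = + suc (suc _)}   (inj₂ refl) _ (+≤+ (s≤s ()))
binary-⊓-complement {a = -[1+ _ ]}        _           () _

binary-singular : ∀ s → (∀ n → s ! n ≡ 0ℤ ⊎ s ! n ≡ 1ℤ) → 𝔾.IsSingular s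
binary-singular s s-binary = (λ n → i≤j⇒i⊓j≡i (binary-nonNeg (s-binary n))) , λ a a≥0 a≤s n →
  binary-⊓-complement (s-binary n) (i⊓j≡i⇒i≤j (a≥0 n)) (i⊓j≡i⇒i≤j (a≤s n))

generated-by-singular : ∀ N x c → (∀ n → N ≤ℕ n → x ! n ≡ c) →
  𝔾.InSubgroupGeneratedBy 𝔾.IsSingular x
generated-by-singular zero x c x≡c = 𝔾.gen-resp (λ n → trans (*-identityʳ c) (sym (x≡c n z≤n)))
  (scale-generated c (constant 1ℤ) (𝔾.gen-base (binary-singular (constant 1ℤ) λ _ → inj₂ refl)))
generated-by-singular (suc M) x c x≡c = 𝔾.gen-resp (λ n → minus-plus (x ! n) (d * δ M n))
  (𝔾.gen-add (generated-by-singular M y c y≡c)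
             (scale-generated d (indicator M) (𝔾.gen-base (binary-singular (indicator M) (δ-binary M)))))
  where
  d : ℤ
  d = x ! M - c
  -- x with its value at M replaced by c, hence constant from M on
  y : Seq
  y = pointwise₂ _-_ x (scale d (indicator M))
  minus-plus : ∀ a b → (a - b) + b ≡ a
  minus-plus = solve-∀
  minus-times-zero : ∀ a b → a - b * 0ℤ ≡ a
  minus-times-zero = solve-∀
  minus-difference : ∀ a b → a - (a - b) * 1ℤ ≡ b
  minus-difference = solve-∀
  open ≡-Reasoning
  y≡c : ∀ n → M ≤ℕ n → y ! n ≡ c
  y≡c n M≤n with ℕ.m≤n⇒m<n∨m≡n M≤n
  ... | inj₁ M<n = begin
    x ! n - d * δ M n  ≡⟨ cong₂ (λ a b → a - d * b) (x≡c n M<n) (δ-off (ℕ.<⇒≢ M<n)) ⟩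
    c - d * 0ℤ         ≡⟨ minus-times-zero c d ⟩
    c                  ∎
  ... | inj₂ refl = begin
    x ! M - d * δ M M  ≡⟨ cong (λ b → x ! M - d * b) (δ-diag M) ⟩
    x ! M - d * 1ℤ     ≡⟨ minus-difference (x ! M) c ⟩
    c                  ∎

seq-isSpecker : 𝔾.IsSpecker
seq-isSpecker x@(_ , c , N , x≡c) = generated-by-singular N x c x≡c

bounded-from : ∀ (f : ℕ → ℤ) N B → (∀ n → N ≤ℕ n → ∣ f n ∣ ≤ℕ B) → ∃ λ B′ → ∀ n → ∣ f n ∣ ≤ℕ B′
bounded-from f zero    B bound = B , λ n → bound n z≤n
bounded-from f (suc N) B bound = bounded-from f N (∣ f N ∣ ℕ.⊔ B) bound′
  where
  bound′ : ∀ n → N ≤ℕ n → ∣ f n ∣ ≤ℕ ∣ f N ∣ ℕ.⊔ B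
  bound′ n N≤n with ℕ.m≤n⇒m<n∨m≡n N≤n
  ... | inj₁ N<n  = ℕ.≤-trans (bound n N<n) (ℕ.m≤n⊔m ∣ f N ∣ B)
  ... | inj₂ refl = ℕ.m≤m⊔n ∣ f N ∣ B

eventuallyConstant⇒bounded : ∀ {f} → EventuallyConstant f → ∃ λ B → ∀ n → ∣ f n ∣ ≤ℕ B
eventuallyConstant⇒bounded {f} (c , N , f≡c) =
  bounded-from f N ∣ c ∣ (λ n N≤n → ℕ.≤-reflexive (cong ∣_∣ (f≡c n N≤n)))

i⊔-i≤∣i∣ : ∀ i → i ⊔ - i ≤ + ∣ i ∣
i⊔-i≤∣i∣ (+ zero)  = ≤-refl
i⊔-i≤∣i∣ (+ suc n) = ≤-refl
i⊔-i≤∣i∣ -[1+ n ]  = ≤-refl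

two : Seq
two = constant (+ 2)

two-isUnit : 𝔾.IsUnit two
two-isUnit = (λ _ → refl) , λ x →
  let B , bound = eventuallyConstant⇒bounded (proj₂ x) in
  suc B , s≤s z≤n , λ m → i≤j⇒i⊓j≡i (begin
    x ! m ⊔ - x ! m             ≤⟨ i⊔-i≤∣i∣ (x ! m) ⟩
    + ∣ x ! m ∣                 ≤⟨ +≤+ (ℕ.≤-trans (bound m) (ℕ.≤-trans (ℕ.n≤1+n B) (ℕ.m≤m*n (suc B) 2))) ⟩
    + (suc B ℕ.* 2)             ≡⟨ pos-* (suc B) 2 ⟩
    + suc B * + 2               ≡⟨ sym (·-pointwise (suc B) two m) ⟩
    (suc B 𝔾.· two) ! m         ∎)
  where open ≤-Reasoning

EvenTail : Seq → Set
EvenTail x = ∃ λ k → Eventually (λ n → x ! n ≡ k + k)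

double-mono-≤ : ∀ {i j} → i ≤ j → i + i ≤ j + j
double-mono-≤ i≤j = +-mono-≤ i≤j i≤j

evenTail : LSubgroup seqLGroup 0ℓ
evenTail = record
  { Member = EvenTail
  ; resp = λ { x≋y (k , x→2k) → k , eventually-map (λ {n} x≡2k → trans (sym (x≋y n)) x≡2k) x→2k }
  ; 0∈ = 0ℤ , 0 , λ _ _ → refl
  ; +∈ = λ { (k , x→2k) (l , y→2l) → k + l ,
      eventually-map₂ (λ x≡2k y≡2l → trans (cong₂ _+_ x≡2k y≡2l) (double-+ k l)) x→2k y→2l }
  ; -∈ = λ { (k , x→2k) → - k , eventually-map (λ x≡2k → trans (cong (-_) x≡2k) (neg-distrib-+ k k)) x→2k }
  ; ∧∈ = λ { (k , x→2k) (l , y→2l) → k ⊓ l , eventually-map₂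
      (λ x≡2k y≡2l → trans (cong₂ _⊓_ x≡2k y≡2l) (sym (mono-≤-distrib-⊓ double-mono-≤ k l))) x→2k y→2l }
  ; ∨∈ = λ { (k , x→2k) (l , y→2l) → k ⊔ l , eventually-map₂
      (λ x≡2k y≡2l → trans (cong₂ _⊔_ x≡2k y≡2l) (sym (mono-≤-distrib-⊔ double-mono-≤ k l))) x→2k y→2l }
  }
  where
  double-+ : ∀ k l → (k + k) + (l + l) ≡ (k + l) + (k + l)
  double-+ = solve-∀

ℍ : LGroup 0ℓ 0ℓ
ℍ = subLGroup seqLGroup evenTail

module ℍ = LGroup ℍ

EventuallyZero : ℍ.Carrier → Set
EventuallyZero x = Eventually (λ n → proj₁ x ! n ≡ 0ℤ)

eventuallyZero-isSubgroup : IsSubgroup ℍ EventuallyZero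
eventuallyZero-isSubgroup = record
  { resp = λ x≈y → eventually-map (λ {n} x≡0 → trans (sym (x≈y n)) x≡0)
  ; 0∈ = 0 , λ _ _ → refl
  ; -∈ = eventually-map (cong (-_))
  ; +∈ = eventually-map₂ (cong₂ _+_)
  }

double-nonNeg⇒nonNeg : ∀ k → 0ℤ ≤ k + k → 0ℤ ≤ k
double-nonNeg⇒nonNeg (+ n)    _  = +≤+ z≤n
double-nonNeg⇒nonNeg -[1+ n ] ()

*δ-cases : ∀ k m n → (m ≡ n × k * δ m n ≡ k) ⊎ k * δ m n ≡ 0ℤ
*δ-cases k m n with m ℕ.≟ n
... | yes refl = inj₁ (refl , trans (cong (k *_) (δ-diag m)) (*-identityʳ k))
... | no m≢n   = inj₂ (trans (cong (k *_) (δ-off m≢n)) (*-zeroʳ k))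

singular⇒eventuallyZero : ∀ s → ℍ.IsSingular s → EventuallyZero s
singular⇒eventuallyZero s@(x , k , N , x≡2k) (s≥0 , s-singular) =
  N , λ n N≤n → trans (x≡2k n N≤n) (cong (λ t → t + t) k≡0)
  where
  x≥0 : ∀ n → 0ℤ ≤ x ! n
  x≥0 n = i⊓j≡i⇒i≤j (s≥0 n)
  x!N≡2k : x ! N ≡ k + k
  x!N≡2k = x≡2k N ℕ.≤-refl
  k≥0 : 0ℤ ≤ k
  k≥0 = double-nonNeg⇒nonNeg k (subst (0ℤ ≤_) x!N≡2k (x≥0 N))
  a : ℍ.Carrier
  a = scale k (indicator N) , 0ℤ , suc N , λ n N<n →
    trans (cong (k *_) (δ-off (ℕ.<⇒≢ N<n))) (*-zeroʳ k)
  a≥0 : ℍ.0# ℍ.≤ a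
  a≥0 n with *δ-cases k N n
  ... | inj₁ (_ , kδ≡k) = i≤j⇒i⊓j≡i (subst (0ℤ ≤_) (sym kδ≡k) k≥0)
  ... | inj₂ kδ≡0       = i≤j⇒i⊓j≡i (≤-reflexive (sym kδ≡0))
  a≤s : a ℍ.≤ s
  a≤s n with *δ-cases k N n
  ... | inj₁ (refl , kδ≡k) =
    i≤j⇒i⊓j≡i (subst₂ _≤_ (sym kδ≡k) (sym x!N≡2k) (i≤i+j k k {{nonNegative k≥0}}))
  ... | inj₂ kδ≡0 = i≤j⇒i⊓j≡i (subst (_≤ x ! n) (sym kδ≡0) (x≥0 n))
  double-minus : ∀ k → (k + k) - k * 1ℤ ≡ k
  double-minus = solve-∀
  open ≡-Reasoning
  k≡0 : k ≡ 0ℤ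
  k≡0 = begin
    k                                 ≡⟨ ⊓-idem k ⟨
    k ⊓ k                             ≡⟨ cong₂ _⊓_ (*-identityʳ k) (double-minus k) ⟨
    k * 1ℤ ⊓ ((k + k) - k * 1ℤ)       ≡⟨ cong₂ (λ b t → k * b ⊓ (t - k * b)) (δ-diag N) x!N≡2k ⟨
    k * δ N N ⊓ (x ! N - k * δ N N)   ≡⟨ s-singular a a≥0 a≤s N ⟩
    0ℤ                                ∎

two∈evenTail : EvenTail two
two∈evenTail = + 1 , 0 , λ _ _ → refl

two-not-eventuallyZero : ¬ EventuallyZero (two , two∈evenTail)
two-not-eventuallyZero (N , two≡0) with two≡0 N ℕ.≤-refl
... | ()

proposition8p2 : Σ (LGroup 0ℓ 0ℓ) λ G → Σ (LGroup.Carrier G) λ u → Σ (LSubgroup G 0ℓ) λ H →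
    LGroup.IsUnitalSpecker G u ×
    Σ (LSubgroup.Member H u) λ u∈H → ¬ LGroup.IsUnitalSpecker (subLGroup G H) (u , u∈H)
proposition8p2 =
  seqLGroup , two , evenTail , (seq-isSpecker , two-isUnit) , two∈evenTail ,
  λ (ℍ-isSpecker , _) → two-not-eventuallyZero
    (generated⊆subgroup ℍ eventuallyZero-isSubgroup (λ {s} → singular⇒eventuallyZero s)
      (ℍ-isSpecker (two , two∈evenTail)))
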